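{- Every multidimensional Welch map is a standard circular Costas map.
   Context: Let $G_1,G_2$ be finite abelian groups (written additively) with $|G_1|+1=|G_2|$, and write $G^*=G\setminus\{0\}$. A map $\varphi:G_1\to G_2$ is called circular Costas if $\varphi$ is injective and, for every $k\in G_1^*$, the difference map $\Delta_{\varphi,k}:G_1\to G_2$, $i\mapsto \varphi(i+k)-\varphi(i)$, is injective. It is called standard if moreover $\mathrm{Im}(\varphi)=G_2^*$. Two maps $\varphi_1:G_1\to G_2$ and $\varphi_2:H_1\to H_2$ (between finite abelian groups) are equivalent if there are group isomorphisms $\psi_1:G_1\to H_1$, $\psi_2:G_2\to H_2$ with $\varphi_1(x)=y \iff \varphi_2(\psi_1(x))=\psi_2(y)$. Let $q=p^m$ be a prime power. A linearized permutation polynomial over $\mathbb{F}_q$ is a polynomial $L(x)=\sum_{j=0}^{m-1}c_jx^{p^j}\in\mathbb{F}_q[x]$ that induces a permutation of $\mathbb{F}_q$. A multidimensional Welch map is any map equivalent to a map $\varphi:\mathbb{Z}_{q-1}\to(\mathbb{F}_q,+)$, $i\mapsto L(\alpha^{i+c})$, where $\alpha$ is a primitive element of $\mathbb{F}_q$, $L$ is a linearized permutation polynomial over $\mathbb{F}_q$, and $c\in\mathbb{Z}$. -}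

module Defs where

open import Level using (0ℓ)
open import Data.Nat as ℕ using (ℕ; zero; suc; _∸_)
open import Data.Nat.DivMod using (_mod_)
open import Data.Nat.Primality using (Prime)
open import Data.Integer as ℤ using (ℤ; +_; -[1+_])
open import Data.Fin using (Fin; toℕ)
open import Data.Product using (Σ; Σ-syntax; ∃; _×_)
open import Relation.Binary.PropositionalEquality using (_≡_; _≢_)
open import Relation.Nullary using (¬_)
open import Algebra.Structures using (IsAbelianGroup; IsCommutativeRing)
open import Function.Bundles using (_↔_; _⇔_)
open import Function.Definitions using (Injective; Bijective)

record FinAbGroup : Set₁ where
  field
    Carrier        : Set
    _+_            : Carrier → Carrier → Carrier
    0#             : Carrier
    -_             : Carrier → Carrier
    isAbelianGroup : IsAbelianGroup _≡_ _+_ 0# -_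
    size           : ℕ
    enum           : Carrier ↔ Fin size

  _-_ : Carrier → Carrier → Carrier
  x - y = x + (- y)

open FinAbGroup using () renaming (Carrier to ∣_∣; size to #_; 0# to 0ᴳ; _+_ to add; _-_ to sub)

IsCircularCostas : (G₁ G₂ : FinAbGroup) → (∣ G₁ ∣ → ∣ G₂ ∣) → Set
IsCircularCostas G₁ G₂ φ =
  (# G₁ ℕ.+ 1 ≡ # G₂)
  × Injective _≡_ _≡_ φ
  × (∀ (k : ∣ G₁ ∣) → k ≢ 0ᴳ G₁ →
       Injective _≡_ _≡_ (λ i → sub G₂ (φ (add G₁ i k)) (φ i)))

ImageIsNonzero : (G₁ G₂ : FinAbGroup) → (∣ G₁ ∣ → ∣ G₂ ∣) → Set
ImageIsNonzero G₁ G₂ φ = ∀ (y : ∣ G₂ ∣) → (∃ λ x → φ x ≡ y) ⇔ (y ≢ 0ᴳ G₂)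

IsStandardCircularCostas : (G₁ G₂ : FinAbGroup) → (∣ G₁ ∣ → ∣ G₂ ∣) → Set
IsStandardCircularCostas G₁ G₂ φ = IsCircularCostas G₁ G₂ φ × ImageIsNonzero G₁ G₂ φ

-- Finite fields (commutative ring, 0 ≠ 1, every nonzero element has
-- an inverse; _⁻¹ is total, its value at 0 is unconstrained),
-- with cardinality witnessed by a bijection with Fin size.

record FiniteField : Set₁ where
  field
    Carrier           : Set
    _+_ _*_           : Carrier → Carrier → Carrier
    -_                : Carrier → Carrier
    0# 1#             : Carrier
    _⁻¹               : Carrier → Carrier
    isCommutativeRing : IsCommutativeRing _≡_ _+_ _*_ -_ 0# 1#
    0≢1               : 0# ≢ 1#
    inverseʳ          : ∀ x → x ≢ 0# → x * (x ⁻¹) ≡ 1#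
    size              : ℕ
    enum              : Carrier ↔ Fin size

  _^_ : Carrier → ℕ → Carrier
  x ^ zero  = 1#
  x ^ suc n = x * (x ^ n)

  _^ℤ_ : Carrier → ℤ → Carrier
  x ^ℤ (+ n)     = x ^ n
  x ^ℤ -[1+ n ]  = (x ⁻¹) ^ suc n

  IsPrimitive : Carrier → Set
  IsPrimitive α = α ≢ 0# × (∀ x → x ≢ 0# → ∃ λ (i : ℕ) → x ≡ α ^ i)

  sumFin : ∀ {m} → (Fin m → Carrier) → Carrier
  sumFin {zero}  f = 0#
  sumFin {suc m} f = f Fin.zero + sumFin (λ j → f (Fin.suc j))
    where import Data.Fin as Fin

  linEval : (p : ℕ) {m : ℕ} → (Fin m → Carrier) → Carrier → Carrier
  linEval p c x = sumFin (λ j → c j * (x ^ (p ℕ.^ toℕ j)))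

_+ₘ_ : ∀ {n} → Fin n → Fin n → Fin n
_+ₘ_ {suc n} i j = (toℕ i ℕ.+ toℕ j) mod suc n

welch : (F : FiniteField) (p : ℕ) {m : ℕ} (coeffs : Fin m → FiniteField.Carrier F)
        (α : FiniteField.Carrier F) (c : ℤ) →
        Fin (FiniteField.size F ∸ 1) → FiniteField.Carrier F
welch F p coeffs α c i = linEval p coeffs (α ^ℤ ((+ toℕ i) ℤ.+ c))
  where open FiniteField F

IsMultidimWelch : (G₁ G₂ : FinAbGroup) → (∣ G₁ ∣ → ∣ G₂ ∣) → Set₁
IsMultidimWelch G₁ G₂ φ =
  Σ[ F ∈ FiniteField ]
  Σ[ p ∈ ℕ ] Σ[ m ∈ ℕ ]
  Prime p × (FiniteField.size F ≡ p ℕ.^ m) ×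
  (Σ[ α ∈ FiniteField.Carrier F ] FiniteField.IsPrimitive F α ×
  (Σ[ coeffs ∈ (Fin m → FiniteField.Carrier F) ]
     Bijective _≡_ _≡_ (FiniteField.linEval F p coeffs) ×
  (Σ[ c ∈ ℤ ]
  (Σ[ ψ₁ ∈ (∣ G₁ ∣ → Fin (FiniteField.size F ∸ 1)) ]
     Bijective _≡_ _≡_ ψ₁ × (∀ x y → ψ₁ (add G₁ x y) ≡ (ψ₁ x +ₘ ψ₁ y)) ×
  (Σ[ ψ₂ ∈ (∣ G₂ ∣ → FiniteField.Carrier F) ]
     Bijective _≡_ _≡_ ψ₂ ×
     (∀ x y → ψ₂ (add G₂ x y) ≡ FiniteField._+_ F (ψ₂ x) (ψ₂ y)) ×
     (∀ (x : ∣ G₁ ∣) (y : ∣ G₂ ∣) →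
        (φ x ≡ y) ⇔ (welch F p coeffs α c (ψ₁ x) ≡ ψ₂ y)))))))

-- Write the Welch map as i ↦ L (αⁱ γ) with γ = α ^ c.  Since q · 1 = 0 in F,
-- the characteristic is p, so the Frobenius map x ↦ xᵖ is additive and the
-- linearized permutation polynomial L is an additive bijection of F.  As α
-- has order q − 1, i ↦ αⁱ γ is a bijection from ℤ_{q−1} onto F*; hence
-- i ↦ L (αⁱ γ) is injective with image L F* = F ∖ {0}, and its difference
-- L (αⁱ⁺ᵏ γ) − L (αⁱ γ) = L (αⁱ γ (αᵏ − 1)) is injective in i because
-- αᵏ ≠ 1 for k ≠ 0.  These properties transfer along the two group
-- isomorphisms of the equivalence.

{-# OPTIONS --safe #-}
module Submission where

open import Level using (0ℓ)
open import Data.Nat as ℕ using (ℕ; zero; suc; NonZero; _∸_; _≤_; _<_; _!; nonTrivial⇒≢1)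
import Data.Nat.Properties as ℕ
open import Data.Nat.Properties using (_!*_!≢0)
open import Data.Nat.DivMod using (_%_; _/_; _mod_; m%n<n; m≡m%n+[m/n]*n; m<n⇒m%n≡m; m/n*n≡m)
open import Data.Nat.Divisibility using (_∣_; divides; ∣1⇒≡1; ∣⇒≤; m∣m*n)
open import Data.Nat.Combinatorics using (_C_; nCn≡1; k![n∸k]!∣n!)
open import Data.Nat.Combinatorics.Specification using (nCk≡n!/k![n-k]!)
open import Data.Nat.Primality using (Prime; euclidsLemma; prime⇒nonTrivial; prime⇒nonZero)
open import Data.Integer as ℤ using (ℤ; +_; -[1+_])
import Data.Integer.Properties as ℤ
open import Data.Fin using (Fin; zero; suc; toℕ; fromℕ; inject₁)
open import Data.Fin.Properties
  using (toℕ<n; toℕ-injective; toℕ-fromℕ<; toℕ-inject₁; toℕ-fromℕ; fromℕ≢inject₁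
        ; inject₁-injective; injective⇒≤; pigeonhole; nonZeroIndex; inj⇒≟)
open import Data.Fin.Permutation using (↔⇒≡)
open import Data.Vec.Functional using (tail; init; last; replicate)
open import Data.Product using (∃; ∃-syntax; _,_; proj₁; proj₂)
open import Data.Sum using (inj₁; inj₂)
open import Algebra.Bundles using (Group; CommutativeRing)
open import Algebra.Core using (Op₁; Op₂)
open import Algebra.Structures using (IsGroup; IsAbelianGroup)
import Algebra.Properties.Group as GroupProperties
open import Function using (_∘_; _↔_; _⇔_; Inverse; Injection; Equivalence; mk⤖; mk↔ₛ′; mk⇔)
open import Function.Definitions using (Injective; Bijective)
open import Function.Properties.Inverse using (↔-refl; ↔-sym; ↔-trans; ↔⇒↣)
open import Function.Properties.Bijection using (⤖⇒↔)
open import Relation.Binary.Definitions using (DecidableEquality; tri<; tri≈; tri>)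
open import Relation.Binary.PropositionalEquality
open import Relation.Nullary using (¬_; yes; no; contradiction)
open import Relation.Nullary.Decidable using (decidable-stable)
open import Defs

prime∤! : ∀ {p j} → Prime p → j < p → ¬ p ∣ j !
prime∤! {j = zero}  p-prime _   p∣1  = nonTrivial⇒≢1 {{prime⇒nonTrivial p-prime}} (∣1⇒≡1 p∣1)
prime∤! {j = suc j} p-prime j<p p∣j! with euclidsLemma (suc j) (j !) p-prime p∣j!
... | inj₁ p∣1+j = ℕ.<⇒≱ j<p (∣⇒≤ p∣1+j)
... | inj₂ p∣j!  = prime∤! p-prime (ℕ.<-trans (ℕ.n<1+n j) j<p) p∣j!

prime∣C : ∀ {p k} → Prime p → 0 < k → k < p → p ∣ p C k
prime∣C {p@(suc q)} {k} p-prime 0<k k<p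
  with euclidsLemma (p C k) (k ! ℕ.* (p ∸ k) !) p-prime
                    (subst (p ∣_) (sym p!≡C·k!·[p∸k]!) (m∣m*n (q !)))
  where
  instance _ = k !* (p ∸ k) !≢0
  p!≡C·k!·[p∸k]! : (p C k) ℕ.* (k ! ℕ.* (p ∸ k) !) ≡ p !
  p!≡C·k!·[p∸k]! = trans (cong (ℕ._* (k ! ℕ.* (p ∸ k) !)) (nCk≡n!/k![n-k]! (ℕ.<⇒≤ k<p)))
                         (m/n*n≡m (k![n∸k]!∣n! (ℕ.<⇒≤ k<p)))
... | inj₁ p∣C = p∣C
... | inj₂ p∣k!·[p∸k]! with euclidsLemma (k !) ((p ∸ k) !) p-prime p∣k!·[p∸k]!
...   | inj₁ p∣k!     = contradiction p∣k! (prime∤! p-prime k<p)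
...   | inj₂ p∣[p∸k]! = contradiction p∣[p∸k]! (prime∤! p-prime (ℕ.∸-monoʳ-< 0<k (ℕ.<⇒≤ k<p)))

bijective⇒size≡ : ∀ {A B : Set} {a b} {f : A → B} → A ↔ Fin a → B ↔ Fin b →
                  Bijective _≡_ _≡_ f → a ≡ b
bijective⇒size≡ A↔a B↔b f-bij = ↔⇒≡ (↔-trans (↔-sym A↔a) (↔-trans (⤖⇒↔ (mk⤖ f-bij)) B↔b))

injective⇒size≤ : ∀ {A : Set} {a b} {f : A → Fin b} → A ↔ Fin a →
                  Injective _≡_ _≡_ f → a ≤ b
injective⇒size≤ A↔a f-inj = injective⇒≤ (Injection.injective (↔⇒↣ (↔-sym A↔a)) ∘ f-inj)

toℕ-+ₘ : ∀ {n} (i j : Fin (suc n)) → toℕ (i +ₘ j) ≡ (toℕ i ℕ.+ toℕ j) % suc n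
toℕ-+ₘ i j = toℕ-fromℕ< _

+ₘ-identityʳ : ∀ {n} (i j : Fin n) → toℕ j ≡ 0 → i +ₘ j ≡ i
+ₘ-identityʳ {suc n} i j j≡0 = toℕ-injective (begin
  toℕ (i +ₘ j)                ≡⟨ toℕ-+ₘ i j ⟩
  (toℕ i ℕ.+ toℕ j) % suc n   ≡⟨ cong (λ t → (toℕ i ℕ.+ t) % suc n) j≡0 ⟩
  (toℕ i ℕ.+ 0) % suc n       ≡⟨ cong (_% suc n) (ℕ.+-identityʳ (toℕ i)) ⟩
  toℕ i % suc n               ≡⟨ m<n⇒m%n≡m (toℕ<n i) ⟩
  toℕ i                       ∎)
  where open ≡-Reasoning

module GroupHomomorphism
  {A B : Set} {_∙₁_ : Op₂ A} {ε₁ : A} {_⁻¹₁ : Op₁ A} {_∙₂_ : Op₂ B} {ε₂ : B} {_⁻¹₂ : Op₁ B}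
  (G₁ : IsGroup _≡_ _∙₁_ ε₁ _⁻¹₁) (G₂ : IsGroup _≡_ _∙₂_ ε₂ _⁻¹₂)
  {f : A → B} (∙-homo : ∀ x y → f (x ∙₁ y) ≡ f x ∙₂ f y)
  where

  private
    module G₁ = IsGroup G₁

    group₂ : Group 0ℓ 0ℓ
    group₂ = record { isGroup = G₂ }

    open GroupProperties group₂ using (identityʳ-unique; inverseʳ-unique)

  ε-homo : f ε₁ ≡ ε₂
  ε-homo = identityʳ-unique (f ε₁) (f ε₁) (trans (sym (∙-homo ε₁ ε₁)) (cong f (G₁.identityˡ ε₁)))

  ⁻¹-homo : ∀ x → f (x ⁻¹₁) ≡ f x ⁻¹₂
  ⁻¹-homo x = inverseʳ-unique (f x) (f (x ⁻¹₁))
    (trans (sym (∙-homo x (x ⁻¹₁))) (trans (cong f (G₁.inverseʳ x)) ε-homo))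

  ∙⁻¹-homo : ∀ x y → f (x ∙₁ (y ⁻¹₁)) ≡ f x ∙₂ (f y ⁻¹₂)
  ∙⁻¹-homo x y = trans (∙-homo x (y ⁻¹₁)) (cong (f x ∙₂_) (⁻¹-homo y))

module FieldProperties (F : FiniteField) where

  open FiniteField F

  commutativeRing : CommutativeRing 0ℓ 0ℓ
  commutativeRing = record { isCommutativeRing = isCommutativeRing }

  open CommutativeRing commutativeRing public
    using (_-_; +-isGroup)
  open CommutativeRing commutativeRing
    using (+-group; *-monoid; +-commutativeMonoid; semiring; commutativeSemiring
          ; +-identityˡ; +-identityʳ; +-comm; *-assoc; *-comm; *-identityˡ; *-identityʳ
          ; distribˡ; zeroˡ; zeroʳ)
  open GroupProperties +-group
    using (identityʳ-unique; //-rightDividesˡ; //-rightDividesʳ)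
  open import Algebra.Properties.Monoid *-monoid
    using (cancelˡ)
  open import Algebra.Properties.Semiring.Exp semiring
    using (^-homo-*; ^-assocʳ) renaming (_^_ to _^ˢ_)
  open import Algebra.Properties.Semiring.Mult semiring
    using (_×_; ×1-homo-*; ×-assoc-*)
  open import Algebra.Properties.CommutativeMonoid.Sum +-commutativeMonoid
    using (sum; sum-permute; ∑-distrib-+; sum-cong-≗; sum-replicate; sum-replicate-zero; sum-init-last)
  open import Algebra.Properties.CommutativeSemiring.Binomial commutativeSemiring
    using (binomialTerm) renaming (theorem to binomial-theorem)
  open ≡-Reasoning

  infix 4 _≟_
  _≟_ : DecidableEquality Carrier
  _≟_ = inj⇒≟ (↔⇒↣ enum)

  enum-injective : Injective _≡_ _≡_ (Inverse.to enum)
  enum-injective = Injection.injective (↔⇒↣ enum)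

  ⁻¹-inverseˡ : ∀ {x} → x ≢ 0# → (x ⁻¹) * x ≡ 1#
  ⁻¹-inverseˡ {x} x≢0 = trans (*-comm (x ⁻¹) x) (inverseʳ x x≢0)

  *-cancelˡ : ∀ {a x y} → a ≢ 0# → a * x ≡ a * y → x ≡ y
  *-cancelˡ {a} {x} {y} a≢0 ax≡ay = begin
    x                  ≡⟨ cancelˡ (⁻¹-inverseˡ a≢0) x ⟨
    (a ⁻¹) * (a * x)   ≡⟨ cong ((a ⁻¹) *_) ax≡ay ⟩
    (a ⁻¹) * (a * y)   ≡⟨ cancelˡ (⁻¹-inverseˡ a≢0) y ⟩
    y                  ∎

  *-cancelʳ : ∀ {a x y} → a ≢ 0# → x * a ≡ y * a → x ≡ y
  *-cancelʳ {a} {x} {y} a≢0 xa≡ya = *-cancelˡ a≢0 (trans (*-comm a x) (trans xa≡ya (*-comm y a)))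

  *-nonzero : ∀ {x y} → x ≢ 0# → y ≢ 0# → x * y ≢ 0#
  *-nonzero {x} x≢0 y≢0 xy≡0 = y≢0 (*-cancelˡ x≢0 (trans xy≡0 (sym (zeroʳ x))))

  ⁻¹-nonzero : ∀ {x} → x ≢ 0# → x ⁻¹ ≢ 0#
  ⁻¹-nonzero {x} x≢0 x⁻¹≡0 = 0≢1 (begin
    0#           ≡⟨ zeroʳ x ⟨
    x * 0#       ≡⟨ cong (x *_) x⁻¹≡0 ⟨
    x * (x ⁻¹)   ≡⟨ inverseʳ x x≢0 ⟩
    1#           ∎)

  ^≡^ˢ : ∀ x n → x ^ n ≡ x ^ˢ n
  ^≡^ˢ x zero    = refl
  ^≡^ˢ x (suc n) = cong (x *_) (^≡^ˢ x n)

  ^-+ : ∀ x m n → x ^ (m ℕ.+ n) ≡ (x ^ m) * (x ^ n)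
  ^-+ x m n rewrite ^≡^ˢ x (m ℕ.+ n) | ^≡^ˢ x m | ^≡^ˢ x n = ^-homo-* x m n

  ^-* : ∀ x m n → x ^ (m ℕ.* n) ≡ (x ^ m) ^ n
  ^-* x m n rewrite ^≡^ˢ x (m ℕ.* n) | ^≡^ˢ (x ^ m) n | ^≡^ˢ x m = sym (^-assocʳ x m n)

  1^n≡1 : ∀ n → 1# ^ n ≡ 1#
  1^n≡1 zero    = refl
  1^n≡1 (suc n) = trans (*-identityˡ (1# ^ n)) (1^n≡1 n)

  ^-nonzero : ∀ {x} n → x ≢ 0# → x ^ n ≢ 0#
  ^-nonzero zero    x≢0 1≡0 = 0≢1 (sym 1≡0)
  ^-nonzero (suc n) x≢0     = *-nonzero x≢0 (^-nonzero n x≢0)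

  ^-cancel : ∀ {x i j} → x ≢ 0# → i ≤ j → x ^ i ≡ x ^ j → x ^ (j ∸ i) ≡ 1#
  ^-cancel {x} {i} {j} x≢0 i≤j xⁱ≡xʲ = sym (*-cancelˡ (^-nonzero i x≢0) (begin
    (x ^ i) * 1#              ≡⟨ *-identityʳ (x ^ i) ⟩
    x ^ i                     ≡⟨ xⁱ≡xʲ ⟩
    x ^ j                     ≡⟨ cong (x ^_) (ℕ.m+[n∸m]≡n i≤j) ⟨
    x ^ (i ℕ.+ (j ∸ i))       ≡⟨ ^-+ x i (j ∸ i) ⟩
    (x ^ i) * (x ^ (j ∸ i))   ∎))

  ^-mod : ∀ {x} m .{{_ : NonZero m}} → x ^ m ≡ 1# → ∀ t → x ^ t ≡ x ^ (t % m)
  ^-mod {x} m xᵐ≡1 t = begin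
    x ^ t                                   ≡⟨ cong (x ^_) (m≡m%n+[m/n]*n t m) ⟩
    x ^ (t % m ℕ.+ (t / m) ℕ.* m)           ≡⟨ ^-+ x (t % m) ((t / m) ℕ.* m) ⟩
    (x ^ (t % m)) * (x ^ ((t / m) ℕ.* m))   ≡⟨ cong (λ k → (x ^ (t % m)) * (x ^ k)) (ℕ.*-comm (t / m) m) ⟩
    (x ^ (t % m)) * (x ^ (m ℕ.* (t / m)))   ≡⟨ cong ((x ^ (t % m)) *_) (^-* x m (t / m)) ⟩
    (x ^ (t % m)) * ((x ^ m) ^ (t / m))     ≡⟨ cong (λ y → (x ^ (t % m)) * (y ^ (t / m))) xᵐ≡1 ⟩
    (x ^ (t % m)) * (1# ^ (t / m))          ≡⟨ cong ((x ^ (t % m)) *_) (1^n≡1 (t / m)) ⟩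
    (x ^ (t % m)) * 1#                      ≡⟨ *-identityʳ (x ^ (t % m)) ⟩
    x ^ (t % m)                             ∎

  ^-+ₘ : ∀ {x m} → x ^ m ≡ 1# → (i j : Fin m) → x ^ toℕ (i +ₘ j) ≡ (x ^ toℕ i) * (x ^ toℕ j)
  ^-+ₘ {x} {suc m} xᵐ≡1 i j = begin
    x ^ toℕ (i +ₘ j)                  ≡⟨ cong (x ^_) (toℕ-+ₘ i j) ⟩
    x ^ ((toℕ i ℕ.+ toℕ j) % suc m)   ≡⟨ ^-mod (suc m) xᵐ≡1 (toℕ i ℕ.+ toℕ j) ⟨
    x ^ (toℕ i ℕ.+ toℕ j)             ≡⟨ ^-+ x (toℕ i) (toℕ j) ⟩
    (x ^ toℕ i) * (x ^ toℕ j)         ∎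

  ^ℤ-suc : ∀ {x} → x ≢ 0# → ∀ z → x ^ℤ ℤ.suc z ≡ x * (x ^ℤ z)
  ^ℤ-suc     x≢0 (+ k)          = refl
  ^ℤ-suc {x} x≢0 -[1+ zero ]    = sym (trans (cong (x *_) (*-identityʳ (x ⁻¹))) (inverseʳ x x≢0))
  ^ℤ-suc {x} x≢0 -[1+ suc k ]   = begin
    (x ⁻¹) ^ suc k                      ≡⟨ *-identityˡ ((x ⁻¹) ^ suc k) ⟨
    1# * ((x ⁻¹) ^ suc k)               ≡⟨ cong (_* ((x ⁻¹) ^ suc k)) (inverseʳ x x≢0) ⟨
    (x * (x ⁻¹)) * ((x ⁻¹) ^ suc k)     ≡⟨ *-assoc x (x ⁻¹) ((x ⁻¹) ^ suc k) ⟩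
    x * ((x ⁻¹) * ((x ⁻¹) ^ suc k))     ∎

  ^ℤ-+ : ∀ {x} → x ≢ 0# → ∀ i c → x ^ℤ (+ i ℤ.+ c) ≡ (x ^ i) * (x ^ℤ c)
  ^ℤ-+ {x} x≢0 zero    c = trans (cong (x ^ℤ_) (ℤ.+-identityˡ c)) (sym (*-identityˡ (x ^ℤ c)))
  ^ℤ-+ {x} x≢0 (suc i) c = begin
    x ^ℤ (+ suc i ℤ.+ c)       ≡⟨ cong (x ^ℤ_) (ℤ.suc-+ i c) ⟩
    x ^ℤ ℤ.suc (+ i ℤ.+ c)     ≡⟨ ^ℤ-suc x≢0 (+ i ℤ.+ c) ⟩
    x * (x ^ℤ (+ i ℤ.+ c))     ≡⟨ cong (x *_) (^ℤ-+ x≢0 i c) ⟩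
    x * ((x ^ i) * (x ^ℤ c))   ≡⟨ *-assoc x (x ^ i) (x ^ℤ c) ⟨
    (x * (x ^ i)) * (x ^ℤ c)   ∎

  ^ℤ-nonzero : ∀ {x} → x ≢ 0# → ∀ c → x ^ℤ c ≢ 0#
  ^ℤ-nonzero x≢0 (+ k)    = ^-nonzero k x≢0
  ^ℤ-nonzero x≢0 -[1+ k ] = ^-nonzero (suc k) (⁻¹-nonzero x≢0)

  +-translation : Carrier → Carrier ↔ Carrier
  +-translation x = mk↔ₛ′ (_+ x) (_+ (- x)) (//-rightDividesˡ x) (//-rightDividesʳ x)

  -- Translation by x permutes F, so Σ F = Σ (F + x) = Σ F + size × x.
  size×x≡0 : ∀ x → size × x ≡ 0#
  size×x≡0 x = identityʳ-unique total (size × x) (sym (begin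
    total                                ≡⟨ sum-permute from shift ⟩
    sum (λ i → from (to (from i + x)))   ≡⟨ sum-cong-≗ (λ i → from∘to (from i + x)) ⟩
    sum (λ i → from i + x)               ≡⟨ ∑-distrib-+ from (replicate size x) ⟩
    total + sum (replicate size x)       ≡⟨ cong (_+_ total) (sum-replicate size) ⟩
    total + (size × x)                   ∎))
    where
    from : Fin size → Carrier
    from = Inverse.from enum
    to : Carrier → Fin size
    to = Inverse.to enum
    from∘to : ∀ y → from (to y) ≡ y
    from∘to = Inverse.strictlyInverseʳ enum
    shift : Fin size ↔ Fin size
    shift = ↔-trans (↔-sym enum) (↔-trans (+-translation x) enum)
    total : Carrier
    total = sum from

  ×1-homo-^ : ∀ p m → (p ℕ.^ m) × 1# ≡ (p × 1#) ^ m
  ×1-homo-^ p zero    = +-identityʳ 1#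
  ×1-homo-^ p (suc m) = trans (×1-homo-* p (p ℕ.^ m)) (cong ((p × 1#) *_) (×1-homo-^ p m))

  size≡p^m⇒p×1≡0 : ∀ {p m} → size ≡ p ℕ.^ m → p × 1# ≡ 0#
  size≡p^m⇒p×1≡0 {p} {m} size≡pᵐ = decidable-stable (p × 1# ≟ 0#) (λ p×1≢0 →
    ^-nonzero m p×1≢0 (trans (sym (×1-homo-^ p m)) (trans (cong (_× 1#) (sym size≡pᵐ)) (size×x≡0 1#))))

  ∣⇒×≡0 : ∀ {p q} → p × 1# ≡ 0# → p ∣ q → ∀ z → q × z ≡ 0#
  ∣⇒×≡0 {p} p×1≡0 (divides r refl) z = begin
    (r ℕ.* p) × z               ≡⟨ cong ((r ℕ.* p) ×_) (*-identityˡ z) ⟨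
    (r ℕ.* p) × (1# * z)        ≡⟨ ×-assoc-* (r ℕ.* p) 1# z ⟨
    ((r ℕ.* p) × 1#) * z        ≡⟨ cong (_* z) (×1-homo-* r p) ⟩
    ((r × 1#) * (p × 1#)) * z   ≡⟨ cong (λ c → ((r × 1#) * c) * z) p×1≡0 ⟩
    ((r × 1#) * 0#) * z         ≡⟨ cong (_* z) (zeroʳ (r × 1#)) ⟩
    0# * z                      ≡⟨ zeroˡ z ⟩
    0#                          ∎

  sum-endpoints : ∀ {n} (t : Fin (suc (suc n)) → Carrier) → (∀ i → t (suc (inject₁ i)) ≡ 0#) →
                  sum t ≡ t zero + t (fromℕ (suc n))
  sum-endpoints {n} t inner≡0 = cong (_+_ (t zero)) (begin
    sum (tail t)                           ≡⟨ sum-init-last (tail t) ⟩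
    sum (init (tail t)) + last (tail t)    ≡⟨ cong (_+ last (tail t)) (sum-cong-≗ inner≡0) ⟩
    sum (replicate n 0#) + last (tail t)   ≡⟨ cong (_+ last (tail t)) (sum-replicate-zero n) ⟩
    0# + last (tail t)                     ≡⟨ +-identityˡ (last (tail t)) ⟩
    last (tail t)                          ∎)

  frobenius : ∀ {p} → Prime p → p × 1# ≡ 0# → ∀ x y → (x + y) ^ p ≡ (x ^ p) + (y ^ p)
  frobenius {zero}       p-prime = contradiction refl (ℕ.≢-nonZero⁻¹ 0 {{prime⇒nonZero p-prime}})
  frobenius {p@(suc p′)} p-prime p×1≡0 x y = begin
    (x + y) ^ p                          ≡⟨ ^≡^ˢ (x + y) p ⟩
    (x + y) ^ˢ p                         ≡⟨ binomial-theorem p x y ⟩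
    sum (term p)                         ≡⟨ sum-endpoints (term p) inner≡0 ⟩
    term p zero + term p (fromℕ p)       ≡⟨ +-comm (term p zero) (term p (fromℕ p)) ⟩
    term p (fromℕ p) + term p zero       ≡⟨ cong₂ _+_ last≡xᵖ first≡yᵖ ⟩
    (x ^ p) + (y ^ p)                    ∎
    where
    term : (n : ℕ) → Fin (suc n) → Carrier
    term = binomialTerm x y
    inner≡0 : ∀ i → term p (suc (inject₁ i)) ≡ 0#
    inner≡0 i rewrite toℕ-inject₁ i =
      ∣⇒×≡0 p×1≡0 (prime∣C p-prime (ℕ.s≤s ℕ.z≤n) (ℕ.s≤s (toℕ<n i))) _
    first≡yᵖ : term p zero ≡ y ^ p
    first≡yᵖ = trans (+-identityʳ _) (trans (*-identityˡ _) (sym (^≡^ˢ y p)))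
    last≡xᵖ : term p (fromℕ p) ≡ x ^ p
    last≡xᵖ rewrite toℕ-fromℕ p′ | nCn≡1 p | ℕ.n∸n≡0 p′ =
      trans (+-identityʳ _) (trans (*-identityʳ _) (sym (^≡^ˢ x p)))

  frobenius-^ : ∀ {p} → Prime p → p × 1# ≡ 0# → ∀ j x y →
                (x + y) ^ (p ℕ.^ j) ≡ (x ^ (p ℕ.^ j)) + (y ^ (p ℕ.^ j))
  frobenius-^ p-prime p×1≡0 zero x y =
    trans (*-identityʳ (x + y)) (cong₂ _+_ (sym (*-identityʳ x)) (sym (*-identityʳ y)))
  frobenius-^ {p} p-prime p×1≡0 (suc j) x y = begin
    (x + y) ^ (p ℕ.* q)                 ≡⟨ ^-* (x + y) p q ⟩
    ((x + y) ^ p) ^ q                   ≡⟨ cong (_^ q) (frobenius p-prime p×1≡0 x y) ⟩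
    ((x ^ p) + (y ^ p)) ^ q             ≡⟨ frobenius-^ p-prime p×1≡0 j (x ^ p) (y ^ p) ⟩
    ((x ^ p) ^ q) + ((y ^ p) ^ q)       ≡⟨ cong₂ _+_ (^-* x p q) (^-* y p q) ⟨
    (x ^ (p ℕ.* q)) + (y ^ (p ℕ.* q))   ∎
    where
    q : ℕ
    q = p ℕ.^ j

  sumFin≡sum : ∀ {m} (f : Fin m → Carrier) → sumFin f ≡ sum f
  sumFin≡sum {zero}  f = refl
  sumFin≡sum {suc m} f = cong (_+_ (f zero)) (sumFin≡sum (λ j → f (suc j)))

  linEval-+ : ∀ {p} → Prime p → p × 1# ≡ 0# → ∀ {m} (c : Fin m → Carrier) x y →
              linEval p c (x + y) ≡ linEval p c x + linEval p c y
  linEval-+ {p} p-prime p×1≡0 {m} c x y = begin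
    linEval p c (x + y)               ≡⟨ sumFin≡sum (term (x + y)) ⟩
    sum (term (x + y))                ≡⟨ sum-cong-≗ termwise ⟩
    sum (λ j → term x j + term y j)   ≡⟨ ∑-distrib-+ (term x) (term y) ⟩
    sum (term x) + sum (term y)       ≡⟨ cong₂ _+_ (sumFin≡sum (term x)) (sumFin≡sum (term y)) ⟨
    linEval p c x + linEval p c y     ∎
    where
    term : Carrier → Fin m → Carrier
    term z j = c j * (z ^ (p ℕ.^ toℕ j))
    termwise : ∀ j → term (x + y) j ≡ term x j + term y j
    termwise j = trans (cong (c j *_) (frobenius-^ p-prime p×1≡0 (toℕ j) x y)) (distribˡ (c j) _ _)

module PrimitiveElement (F : FiniteField) {α} (α-primitive : FiniteField.IsPrimitive F α) where

  open FiniteField F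
  open FieldProperties F

  n : ℕ
  n = size ∸ 1

  size≡1+n : size ≡ suc n
  size≡1+n = sym (ℕ.suc-pred size {{nonZeroIndex (Inverse.to enum 0#)}})

  α≢0 : α ≢ 0#
  α≢0 = proj₁ α-primitive

  log : ∀ {x} → x ≢ 0# → ℕ
  log {x} x≢0 = proj₁ (proj₂ α-primitive x x≢0)

  α^log : ∀ {x} (x≢0 : x ≢ 0#) → α ^ log x≢0 ≡ x
  α^log {x} x≢0 = sym (proj₂ (proj₂ α-primitive x x≢0))

  n≢0 : n ≢ 0
  n≢0 n≡0 = 0≢1 (enum-injective (toℕ-injective (trans (index≡0 0#) (sym (index≡0 1#)))))
    where
    index≡0 : ∀ x → toℕ (Inverse.to enum x) ≡ 0
    index≡0 x = ℕ.n<1⇒n≡0 (subst (toℕ (Inverse.to enum x) <_) size≡1 (toℕ<n (Inverse.to enum x)))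
      where
      size≡1 : size ≡ 1
      size≡1 = trans size≡1+n (cong suc n≡0)

  instance
    n-nonZero : NonZero n
    n-nonZero = ℕ.≢-nonZero n≢0

  α^k≡1⇒n≤k : ∀ k .{{_ : NonZero k}} → α ^ k ≡ 1# → n ≤ k
  α^k≡1⇒n≤k k αᵏ≡1 = ℕ.s≤s⁻¹ (subst (_≤ suc k) size≡1+n (injective⇒size≤ enum code-injective))
    where
    code : Carrier → Fin (suc k)
    code x with x ≟ 0#
    ... | yes _   = fromℕ k
    ... | no x≢0  = inject₁ (log x≢0 mod k)
    code-injective : Injective _≡_ _≡_ code
    code-injective {x} {y} code≡ with x ≟ 0# | y ≟ 0#
    ... | yes x≡0 | yes y≡0 = trans x≡0 (sym y≡0)
    ... | yes _   | no _    = contradiction code≡ fromℕ≢inject₁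
    ... | no _    | yes _   = contradiction (sym code≡) fromℕ≢inject₁
    ... | no x≢0  | no y≢0  = begin
      x                   ≡⟨ α^log x≢0 ⟨
      α ^ log x≢0         ≡⟨ ^-mod k αᵏ≡1 (log x≢0) ⟩
      α ^ (log x≢0 % k)   ≡⟨ cong (α ^_) logs≡ ⟩
      α ^ (log y≢0 % k)   ≡⟨ ^-mod k αᵏ≡1 (log y≢0) ⟨
      α ^ log y≢0         ≡⟨ α^log y≢0 ⟩
      y                   ∎
      where
      open ≡-Reasoning
      logs≡ : log x≢0 % k ≡ log y≢0 % k
      logs≡ = trans (sym (toℕ-fromℕ< _)) (trans (cong toℕ (inject₁-injective code≡)) (toℕ-fromℕ< _))

  α^-distinct : ∀ {i j} → i < j → j < n → α ^ i ≢ α ^ j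
  α^-distinct {i} {j} i<j j<n αⁱ≡αʲ = ℕ.<⇒≱ j<n (ℕ.≤-trans n≤j∸i (ℕ.m∸n≤m j i))
    where
    n≤j∸i : n ≤ j ∸ i
    n≤j∸i = α^k≡1⇒n≤k (j ∸ i) {{ℕ.>-nonZero (ℕ.m<n⇒0<n∸m i<j)}}
                      (^-cancel α≢0 (ℕ.<⇒≤ i<j) αⁱ≡αʲ)

  α^-injective : ∀ {i j} → i < n → j < n → α ^ i ≡ α ^ j → i ≡ j
  α^-injective {i} {j} i<n j<n αⁱ≡αʲ with ℕ.<-cmp i j
  ... | tri< i<j _ _ = contradiction αⁱ≡αʲ (α^-distinct i<j j<n)
  ... | tri≈ _ i≡j _ = i≡j
  ... | tri> _ _ j<i = contradiction (sym αⁱ≡αʲ) (α^-distinct j<i i<n)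

  -- Pigeonhole on the n + 2 elements 0, α⁰, …, αⁿ of a field of size n + 1.
  α^n≡1 : α ^ n ≡ 1#
  α^n≡1 with pigeonhole size<2+n zero-and-powers
    where
    size<2+n : size < suc (suc n)
    size<2+n = subst (_< suc (suc n)) (sym size≡1+n) (ℕ.n<1+n (suc n))
    zero-and-powers : Fin (suc (suc n)) → Fin size
    zero-and-powers zero    = Inverse.to enum 0#
    zero-and-powers (suc i) = Inverse.to enum (α ^ toℕ i)
  ... | zero  , suc j , _         , 0≡αʲ  =
    contradiction (sym (enum-injective 0≡αʲ)) (^-nonzero (toℕ j) α≢0)
  ... | suc i , suc j , ℕ.s≤s i<j , αⁱ≡αʲ = subst (λ d → α ^ d ≡ 1#) j∸i≡n αʲ⁻ⁱ≡1
    where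
    αʲ⁻ⁱ≡1 : α ^ (toℕ j ∸ toℕ i) ≡ 1#
    αʲ⁻ⁱ≡1 = ^-cancel α≢0 (ℕ.<⇒≤ i<j) (enum-injective αⁱ≡αʲ)
    j∸i≡n : toℕ j ∸ toℕ i ≡ n
    j∸i≡n = ℕ.≤-antisym (ℕ.≤-trans (ℕ.m∸n≤m (toℕ j) (toℕ i)) (ℕ.s≤s⁻¹ (toℕ<n j)))
                        (α^k≡1⇒n≤k _ {{ℕ.>-nonZero (ℕ.m<n⇒0<n∸m i<j)}} αʲ⁻ⁱ≡1)

  nonzero⇒α^ : ∀ {x} → x ≢ 0# → ∃[ j ] x ≡ α ^ toℕ {n} j
  nonzero⇒α^ {x} x≢0 = log x≢0 mod n , (begin
    x                         ≡⟨ α^log x≢0 ⟨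
    α ^ log x≢0               ≡⟨ ^-mod n α^n≡1 (log x≢0) ⟩
    α ^ (log x≢0 % n)         ≡⟨ cong (α ^_) (toℕ-fromℕ< (m%n<n (log x≢0) n)) ⟨
    α ^ toℕ (log x≢0 mod n)   ∎)
    where open ≡-Reasoning

module WelchMap
  (F : FiniteField) {p m} (p-prime : Prime p) (size≡pᵐ : FiniteField.size F ≡ p ℕ.^ m)
  {α} (α-primitive : FiniteField.IsPrimitive F α)
  {coeffs : Fin m → FiniteField.Carrier F} (L-bijective : Bijective _≡_ _≡_ (FiniteField.linEval F p coeffs))
  (c : ℤ)
  where

  open FiniteField F
  open FieldProperties F
  open PrimitiveElement F α-primitive
  open CommutativeRing commutativeRing using (ring; +-group; *-monoid; *-commutativeSemigroup; *-identityʳ)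
  open GroupProperties +-group using (x∙y⁻¹≈ε⇒x≈y)
  open import Algebra.Properties.Ring ring using (x[y-z]≈xy-xz)
  open import Algebra.Properties.Monoid *-monoid using (cancelʳ)
  open import Algebra.Properties.CommutativeSemigroup *-commutativeSemigroup using (xy∙z≈xz∙y)
  open ≡-Reasoning

  L : Carrier → Carrier
  L = linEval p coeffs

  L-injective : Injective _≡_ _≡_ L
  L-injective = proj₁ L-bijective

  module L-additive = GroupHomomorphism +-isGroup +-isGroup
    (linEval-+ p-prime (size≡p^m⇒p×1≡0 {p} {m} size≡pᵐ) coeffs)

  γ : Carrier
  γ = α ^ℤ c

  γ≢0 : γ ≢ 0#
  γ≢0 = ^ℤ-nonzero α≢0 c

  w : Fin n → Carrier
  w = welch F p coeffs α c

  w≡L[αⁱγ] : ∀ i → w i ≡ L ((α ^ toℕ i) * γ)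
  w≡L[αⁱγ] i = cong L (^ℤ-+ α≢0 (toℕ i) c)

  αⁱγ-injective : ∀ {i j : Fin n} → (α ^ toℕ i) * γ ≡ (α ^ toℕ j) * γ → i ≡ j
  αⁱγ-injective {i} {j} eq = toℕ-injective (α^-injective (toℕ<n i) (toℕ<n j) (*-cancelʳ γ≢0 eq))

  w-injective : Injective _≡_ _≡_ w
  w-injective {i} {j} wᵢ≡wⱼ =
    αⁱγ-injective (L-injective (trans (sym (w≡L[αⁱγ] i)) (trans wᵢ≡wⱼ (w≡L[αⁱγ] j))))

  w-difference : ∀ i k → w (i +ₘ k) - w i ≡ L (((α ^ toℕ i) * γ) * ((α ^ toℕ k) - 1#))
  w-difference i k = begin
    w (i +ₘ k) - w i                    ≡⟨ cong₂ _-_ (w≡L[αⁱγ] (i +ₘ k)) (w≡L[αⁱγ] i) ⟩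
    L ((α ^ toℕ (i +ₘ k)) * γ) - L X    ≡⟨ L-additive.∙⁻¹-homo ((α ^ toℕ (i +ₘ k)) * γ) X ⟨
    L (((α ^ toℕ (i +ₘ k)) * γ) - X)    ≡⟨ cong (λ y → L ((y * γ) - X)) (^-+ₘ α^n≡1 i k) ⟩
    L (((αⁱ * αᵏ) * γ) - X)             ≡⟨ cong (λ y → L (y - X)) (xy∙z≈xz∙y αⁱ αᵏ γ) ⟩
    L ((X * αᵏ) - X)                    ≡⟨ cong (λ y → L ((X * αᵏ) - y)) (*-identityʳ X) ⟨
    L ((X * αᵏ) - (X * 1#))             ≡⟨ cong L (x[y-z]≈xy-xz X αᵏ 1#) ⟨
    L (X * (αᵏ - 1#))                   ∎
    where
    αⁱ αᵏ X : Carrier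
    αⁱ = α ^ toℕ i
    αᵏ = α ^ toℕ k
    X = αⁱ * γ

  w-costas : ∀ k → toℕ k ≢ 0 → Injective _≡_ _≡_ (λ i → w (i +ₘ k) - w i)
  w-costas k k≢0 {i} {j} Δᵢ≡Δⱼ = αⁱγ-injective (*-cancelʳ αᵏ-1≢0
    (L-injective (trans (sym (w-difference i k)) (trans Δᵢ≡Δⱼ (w-difference j k)))))
    where
    αᵏ-1≢0 : (α ^ toℕ k) - 1# ≢ 0#
    αᵏ-1≢0 αᵏ-1≡0 =
      k≢0 (α^-injective (toℕ<n k) (ℕ.>-nonZero⁻¹ n) (x∙y⁻¹≈ε⇒x≈y (α ^ toℕ k) 1# αᵏ-1≡0))

  w-image : ∀ y → (∃ λ i → w i ≡ y) ⇔ y ≢ 0#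
  w-image y = mk⇔ image⇒nonzero nonzero⇒image
    where
    image⇒nonzero : (∃ λ i → w i ≡ y) → y ≢ 0#
    image⇒nonzero (i , wᵢ≡y) y≡0 = *-nonzero (^-nonzero (toℕ i) α≢0) γ≢0
      (L-injective (trans (sym (w≡L[αⁱγ] i)) (trans wᵢ≡y (trans y≡0 (sym L-additive.ε-homo)))))
    nonzero⇒image : y ≢ 0# → ∃ λ i → w i ≡ y
    nonzero⇒image y≢0 = j , (begin
      w j                    ≡⟨ w≡L[αⁱγ] j ⟩
      L ((α ^ toℕ j) * γ)    ≡⟨ cong (λ t → L (t * γ)) zγ⁻¹≡αʲ ⟨
      L ((z * (γ ⁻¹)) * γ)   ≡⟨ cong L (cancelʳ (⁻¹-inverseˡ γ≢0) z) ⟩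
      L z                    ≡⟨ Lz≡y ⟩
      y                      ∎)
      where
      z : Carrier
      z = proj₁ (proj₂ L-bijective y)
      Lz≡y : L z ≡ y
      Lz≡y = proj₂ (proj₂ L-bijective y) refl
      z≢0 : z ≢ 0#
      z≢0 z≡0 = y≢0 (trans (sym Lz≡y) (trans (cong L z≡0) L-additive.ε-homo))
      zγ⁻¹-as-power : ∃[ j ] z * (γ ⁻¹) ≡ α ^ toℕ j
      zγ⁻¹-as-power = nonzero⇒α^ (*-nonzero z≢0 (⁻¹-nonzero γ≢0))
      j : Fin n
      j = proj₁ zγ⁻¹-as-power
      zγ⁻¹≡αʲ : z * (γ ⁻¹) ≡ α ^ toℕ j
      zγ⁻¹≡αʲ = proj₂ zγ⁻¹-as-power

module TransportAlongEquivalence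
  (G₁ G₂ : FinAbGroup) (F : FiniteField) {n} (size≡1+n : FiniteField.size F ≡ suc n)
  (w : Fin n → FiniteField.Carrier F) {φ : FinAbGroup.Carrier G₁ → FinAbGroup.Carrier G₂}
  {ψ₁ : FinAbGroup.Carrier G₁ → Fin n} (ψ₁-bijective : Bijective _≡_ _≡_ ψ₁)
  (ψ₁-homo : ∀ x y → ψ₁ (FinAbGroup._+_ G₁ x y) ≡ (ψ₁ x +ₘ ψ₁ y))
  {ψ₂ : FinAbGroup.Carrier G₂ → FiniteField.Carrier F} (ψ₂-bijective : Bijective _≡_ _≡_ ψ₂)
  (ψ₂-homo : ∀ x y → ψ₂ (FinAbGroup._+_ G₂ x y) ≡ FiniteField._+_ F (ψ₂ x) (ψ₂ y))
  (ψ₂∘φ≡w∘ψ₁ : ∀ x → ψ₂ (φ x) ≡ w (ψ₁ x))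
  where

  open FiniteField F using (0#; size; enum)
  open FieldProperties F using (+-isGroup; _-_)
  module G₁ = FinAbGroup G₁
  module G₂ = FinAbGroup G₂
  module ψ₂-additive = GroupHomomorphism (IsAbelianGroup.isGroup G₂.isAbelianGroup) +-isGroup ψ₂-homo
  open ≡-Reasoning

  ψ₁-injective : Injective _≡_ _≡_ ψ₁
  ψ₁-injective = proj₁ ψ₁-bijective

  ψ₂-injective : Injective _≡_ _≡_ ψ₂
  ψ₂-injective = proj₁ ψ₂-bijective

  size-G₁+1≡size-G₂ : G₁.size ℕ.+ 1 ≡ G₂.size
  size-G₁+1≡size-G₂ = begin
    G₁.size ℕ.+ 1   ≡⟨ cong (ℕ._+ 1) (bijective⇒size≡ G₁.enum ↔-refl ψ₁-bijective) ⟩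
    n ℕ.+ 1         ≡⟨ ℕ.+-comm n 1 ⟩
    suc n           ≡⟨ size≡1+n ⟨
    size            ≡⟨ bijective⇒size≡ G₂.enum enum ψ₂-bijective ⟨
    G₂.size         ∎

  φ-injective : Injective _≡_ _≡_ w → Injective _≡_ _≡_ φ
  φ-injective w-injective {x} {y} φx≡φy = ψ₁-injective (w-injective
    (trans (sym (ψ₂∘φ≡w∘ψ₁ x)) (trans (cong ψ₂ φx≡φy) (ψ₂∘φ≡w∘ψ₁ y))))

  ψ₁-nonzero : ∀ {k} → k ≢ G₁.0# → toℕ (ψ₁ k) ≢ 0
  ψ₁-nonzero {k} k≢0 ψ₁k≡0 = k≢0 (begin
    k              ≡⟨ IsAbelianGroup.identityˡ G₁.isAbelianGroup k ⟨
    G₁.0# G₁.+ k   ≡⟨ ψ₁-injective ψ₁[0+k]≡ψ₁0 ⟩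
    G₁.0#          ∎)
    where
    ψ₁[0+k]≡ψ₁0 : ψ₁ (G₁.0# G₁.+ k) ≡ ψ₁ G₁.0#
    ψ₁[0+k]≡ψ₁0 = trans (ψ₁-homo G₁.0# k) (+ₘ-identityʳ (ψ₁ G₁.0#) (ψ₁ k) ψ₁k≡0)

  ψ₂-difference : ∀ k x → ψ₂ (φ (x G₁.+ k) G₂.- φ x) ≡ w (ψ₁ x +ₘ ψ₁ k) - w (ψ₁ x)
  ψ₂-difference k x = begin
    ψ₂ (φ (x G₁.+ k) G₂.- φ x)     ≡⟨ ψ₂-additive.∙⁻¹-homo (φ (x G₁.+ k)) (φ x) ⟩
    ψ₂ (φ (x G₁.+ k)) - ψ₂ (φ x)   ≡⟨ cong₂ _-_ (ψ₂∘φ≡w∘ψ₁ _) (ψ₂∘φ≡w∘ψ₁ x) ⟩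
    w (ψ₁ (x G₁.+ k)) - w (ψ₁ x)   ≡⟨ cong (λ i → w i - w (ψ₁ x)) (ψ₁-homo x k) ⟩
    w (ψ₁ x +ₘ ψ₁ k) - w (ψ₁ x)    ∎

  φ-costas : (∀ k → toℕ k ≢ 0 → Injective _≡_ _≡_ (λ i → w (i +ₘ k) - w i)) →
             ∀ k → k ≢ G₁.0# → Injective _≡_ _≡_ (λ i → φ (i G₁.+ k) G₂.- φ i)
  φ-costas w-costas k k≢0 {x} {y} Δx≡Δy = ψ₁-injective (w-costas (ψ₁ k) (ψ₁-nonzero k≢0)
    (trans (sym (ψ₂-difference k x)) (trans (cong ψ₂ Δx≡Δy) (ψ₂-difference k y))))

  φ-image : (∀ y → (∃ λ i → w i ≡ y) ⇔ y ≢ 0#) → ImageIsNonzero G₁ G₂ φ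
  φ-image w-image y = mk⇔ image⇒nonzero nonzero⇒image
    where
    image⇒nonzero : (∃ λ x → φ x ≡ y) → y ≢ G₂.0#
    image⇒nonzero (x , φx≡y) y≡0 =
      Equivalence.to (w-image (ψ₂ y)) (ψ₁ x , trans (sym (ψ₂∘φ≡w∘ψ₁ x)) (cong ψ₂ φx≡y))
                     (trans (cong ψ₂ y≡0) ψ₂-additive.ε-homo)
    nonzero⇒image : y ≢ G₂.0# → ∃ λ x → φ x ≡ y
    nonzero⇒image y≢0 =
      x , ψ₂-injective (trans (ψ₂∘φ≡w∘ψ₁ x) (trans (cong w ψ₁x≡i) wᵢ≡ψ₂y))
      where
      ψ₂y≢0 : ψ₂ y ≢ 0#
      ψ₂y≢0 ψ₂y≡0 = y≢0 (ψ₂-injective (trans ψ₂y≡0 (sym ψ₂-additive.ε-homo)))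
      i : Fin n
      i = proj₁ (Equivalence.from (w-image (ψ₂ y)) ψ₂y≢0)
      wᵢ≡ψ₂y : w i ≡ ψ₂ y
      wᵢ≡ψ₂y = proj₂ (Equivalence.from (w-image (ψ₂ y)) ψ₂y≢0)
      x : FinAbGroup.Carrier G₁
      x = proj₁ (proj₂ ψ₁-bijective i)
      ψ₁x≡i : ψ₁ x ≡ i
      ψ₁x≡i = proj₂ (proj₂ ψ₁-bijective i) refl

proposition3p2 : (G₁ G₂ : FinAbGroup) (φ : FinAbGroup.Carrier G₁ → FinAbGroup.Carrier G₂) →
    IsMultidimWelch G₁ G₂ φ → IsStandardCircularCostas G₁ G₂ φ
proposition3p2 G₁ G₂ φ (F , p , m , p-prime , size≡pᵐ , α , α-primitive , coeffs , L-bijective , c ,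
                        ψ₁ , ψ₁-bijective , ψ₁-homo , ψ₂ , ψ₂-bijective , ψ₂-homo , φ≈welch) =
  (size-G₁+1≡size-G₂ , φ-injective w-injective , φ-costas w-costas) , φ-image w-image
  where
  open PrimitiveElement F α-primitive using (size≡1+n)
  open WelchMap F p-prime size≡pᵐ α-primitive {coeffs} L-bijective c
    using (w; w-injective; w-costas; w-image)

  ψ₂∘φ≡w∘ψ₁ : ∀ x → ψ₂ (φ x) ≡ w (ψ₁ x)
  ψ₂∘φ≡w∘ψ₁ x = sym (Equivalence.to (φ≈welch x (φ x)) refl)

  open TransportAlongEquivalence G₁ G₂ F size≡1+n w
    ψ₁-bijective ψ₁-homo ψ₂-bijective ψ₂-homo ψ₂∘φ≡w∘ψ₁
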